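{- Let $q=p^h$ with $p$ prime. In $\mathrm{PG}(2,q)$ let $\{P_1,P_2,Q_1,Q_2\}$ be a frame, let $P_3=P_1P_2\cap Q_1Q_2$, and let $S=\{P_1,P_2,P_3,Q_1,Q_2\}$. Let $\widetilde S$ be the restricted closure of $S$ with respect to $\{P_1,P_2,P_3\}$. Then the set of points of $\widetilde S$ not on the line $P_1P_2$ is exactly the set of points of the $\mathbb{F}_p$-subplane determined by $\{P_1,P_2,Q_1,Q_2\}$ not on the line $P_1P_2$.
   Context: A frame of $\mathrm{PG}(2,q)$ is a set of four points, no three collinear. The $\mathbb{F}_p$-subplane determined by a frame is the set of points which, in homogeneous coordinates for which the frame is $\{(1,0,0),(0,1,0),(0,0,1),(1,1,1)\}$, have all coordinates in $\mathbb{F}_p$ (up to scalar). Restricted closure: given a point set $S$ and points $P_1,\dots,P_m\in S$, set $S_0=S$; given $S_i$, let $\mathcal{A}_i$ be the set of all lines $\langle P_j,Q\rangle$ with $j\in\{1,\dots,m\}$, $Q\in S_i$, $Q\neq P_j$, and let $S_{i+1}$ be $S_i$ together with all points that are the intersection of two distinct lines of $\mathcal{A}_i$. The restricted closure $\widetilde S$ of $S$ with respect to $\{P_1,\dots,P_m\}$ is the union of the (eventually stabilising) sets $S_i$. -}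

module Defs where

open import Level using (Level; _⊔_) renaming (suc to lsuc)
open import Algebra.Bundles using (CommutativeRing)
open import Data.Nat using (ℕ; zero; suc)
open import Data.Fin using (Fin)
open import Data.Product using (Σ; ∃; _×_; _,_)
open import Data.Sum using (_⊎_)
open import Relation.Nullary using (¬_)
open import Relation.Binary.PropositionalEquality using (_≡_)

record Field (c ℓ : Level) : Set (lsuc (c ⊔ ℓ)) where
  field
    commutativeRing : CommutativeRing c ℓ
  open CommutativeRing commutativeRing public
  field
    0≉1     : ¬ (0# ≈ 1#)
    inverse : ∀ x → ¬ (x ≈ 0#) → ∃ λ y → (x * y) ≈ 1#

HasOrder : ∀ {c ℓ} → Field c ℓ → ℕ → Set (c ⊔ ℓ)
HasOrder F q = Σ (Fin q → Carrier) λ e →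
    (∀ x → ∃ λ i → e i ≈ x)
  × (∀ i j → e i ≈ e j → i ≡ j)
  where open Field F

module PG {c ℓ} (F : Field c ℓ) where
  open Field F

  V : Set c
  V = Carrier × Carrier × Carrier

  _≈₃_ : V → V → Set ℓ
  (a , b , d) ≈₃ (a' , b' , d') = (a ≈ a') × (b ≈ b') × (d ≈ d')

  0₃ : V
  0₃ = 0# , 0# , 0#

  _·₃_ : Carrier → V → V
  k ·₃ (a , b , d) = (k * a) , (k * b) , (k * d)

  _∼ᵥ_ : V → V → Set (c ⊔ ℓ)
  v ∼ᵥ w = ∃ λ k → ¬ (k ≈ 0#) × (v ≈₃ (k ·₃ w))

  -- points of PG(2,F): nonzero vectors (considered up to ∼)
  Point : Set (c ⊔ ℓ)
  Point = Σ V λ v → ¬ (v ≈₃ 0₃)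

  vec : Point → V
  vec (v , _) = v

  _∼_ : Point → Point → Set (c ⊔ ℓ)
  X ∼ Y = vec X ∼ᵥ vec Y

  det : V → V → V → Carrier
  det (a1 , a2 , a3) (b1 , b2 , b3) (d1 , d2 , d3) =
    (a1 * ((b2 * d3) - (b3 * d2)) - a2 * ((b1 * d3) - (b3 * d1)))
      + a3 * ((b1 * d2) - (b2 * d1))

  Collinear : Point → Point → Point → Set ℓ
  Collinear A B C = det (vec A) (vec B) (vec C) ≈ 0#

  Frame : Point → Point → Point → Point → Set ℓ
  Frame A B C D = ¬ Collinear A B C × ¬ Collinear A B D
                × ¬ Collinear A C D × ¬ Collinear B C D

  -- Restricted closure of S with respect to the centres (predicate Cen).
  -- Least set containing S and closed under: if A, A' are centres, Q, Q' are
  -- in the set with Q ≁ A, Q' ≁ A', the lines ⟨A,Q⟩ and ⟨A',Q'⟩ are distinct,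
  -- and X lies on both, then X is in the set.  (This is the union of the S_i.)
  data Closure (S Cen : Point → Set (c ⊔ ℓ)) : Point → Set (c ⊔ ℓ) where
    base : ∀ {X} → S X → Closure S Cen X
    meet : ∀ {X A Q A' Q'} →
           Cen A → Closure S Cen Q → ¬ (Q ∼ A) →
           Cen A' → Closure S Cen Q' → ¬ (Q' ∼ A') →
           ¬ (Collinear A Q A' × Collinear A Q Q') →
           Collinear A Q X → Collinear A' Q' X →
           Closure S Cen X

  -- image of ℕ in F (the prime subfield, in characteristic p)
  fromℕ : ℕ → Carrier
  fromℕ zero    = 0#
  fromℕ (suc n) = 1# + fromℕ n

  InPrimeField : Carrier → Set ℓ
  InPrimeField a = ∃ λ n → a ≈ fromℕ n

  -- 3×3 matrices as triples of rows, acting on column vectors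
  M3 : Set c
  M3 = V × V × V

  dot : V → V → Carrier
  dot (a1 , a2 , a3) (b1 , b2 , b3) = ((a1 * b1) + (a2 * b2)) + (a3 * b3)

  apply : M3 → V → V
  apply (r1 , r2 , r3) v = dot r1 v , dot r2 v , dot r3 v

  detM : M3 → Carrier
  detM (r1 , r2 , r3) = det r1 r2 r3

  e₁ e₂ e₃ e₁₂₃ : V
  e₁ = 1# , 0# , 0#
  e₂ = 0# , 1# , 0#
  e₃ = 0# , 0# , 1#
  e₁₂₃ = 1# , 1# , 1#

  -- X lies in the F_p-subplane determined by the frame {A,B,C,D}: in homogeneous
  -- coordinates (an invertible change of coordinates M) in which the frame is
  -- {(1,0,0),(0,1,0),(0,0,1),(1,1,1)}, X has all coordinates in F_p up to scalar.
  InSubplane : Point → Point → Point → Point → Point → Set (c ⊔ ℓ)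
  InSubplane A B C D X = ∃ λ (M : M3) →
      ¬ (detM M ≈ 0#)
    × (apply M (vec A) ∼ᵥ e₁) × (apply M (vec B) ∼ᵥ e₂)
    × (apply M (vec C) ∼ᵥ e₃) × (apply M (vec D) ∼ᵥ e₁₂₃)
    × ∃ λ (w : V) → (apply M (vec X) ∼ᵥ w)
        × InPrimeField (Data.Product.proj₁ w)
        × InPrimeField (Data.Product.proj₁ (Data.Product.proj₂ w))
        × InPrimeField (Data.Product.proj₂ (Data.Product.proj₂ w))

  In3 : Point → Point → Point → Point → Set (c ⊔ ℓ)
  In3 A B C X = X ∼ A ⊎ X ∼ B ⊎ X ∼ C

  In5 : Point → Point → Point → Point → Point → Point → Set (c ⊔ ℓ)
  In5 A B C D E X = X ∼ A ⊎ X ∼ B ⊎ X ∼ C ⊎ X ∼ D ⊎ X ∼ E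

-- In coordinates where P₁, P₂, Q₁, Q₂ are (1,0,0), (0,1,0), (0,0,1), (1,1,1), collinearity
-- forces P₃ = (1,1,0), and the lines through the centres P₁, P₂, P₃ are z = 0 and the lines
-- y = n z, x = m z, y − x = d z.  A centre joined to a point (m, n, 1) with m, n ∈ 𝔽ₚ (or to
-- another centre) gives such a line with parameter in 𝔽ₚ, and two distinct such lines meet in a
-- centre or in another such point, because 𝔽ₚ is closed under + and −.  So the closure stays in
-- the 𝔽ₚ-subplane.  Conversely, starting from Q₁ = (0,0,1) and Q₂ = (1,1,1), intersecting such
-- lines walks along the axes and then fills in every (a, b, 1) with a, b ∈ ℕ; a subplane point off
-- P₁P₂ is of this form after scaling by the inverse of its last coordinate, which lies in 𝔽ₚ.

module Submission where

open import Level using (_⊔_; Lift; lift)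
open import Algebra.Bundles using (CommutativeRing; RawRing)
open import Data.Nat as ℕ using (ℕ; zero; suc; _^_)
import Data.Nat.Properties as ℕ
open import Data.Nat.Primality using (Prime)
open import Data.Integer as ℤ using (ℤ; +_; -[1+_]; _⊖_; _◃_; sign; ∣_∣)
import Data.Integer.Properties as ℤ
open import Data.Sign as Sign using (Sign)
open import Data.Fin using (Fin; toℕ)
import Data.Fin.Properties as Fin
open import Data.Maybe using (Maybe; just; nothing)
open import Data.Product using (Σ; ∃; _,_; proj₁; proj₂)
open import Data.Sum using (inj₁; inj₂)
open import Data.Empty using (⊥; ⊥-elim)
open import Data.Unit using (⊤; tt)
open import Function.Bundles using (_⇔_; mk⇔)
open import Relation.Nullary using (¬_; yes; no)
open import Relation.Binary.PropositionalEquality as ≡ using (_≡_)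
open import Defs

-- Algebra.Solver.Ring for R with integer coefficients: unlike Tactic.RingSolver over R
-- itself, it can cancel terms, since equality of coefficients is decidable.
module IntegerCoefficients {c ℓ} (R : CommutativeRing c ℓ) where
  open CommutativeRing R
  open import Relation.Binary.Reasoning.Setoid setoid
  open import Algebra.Properties.Semiring.Mult.TCOptimised semiring using (_×_; 1+×; ×-homo-+; ×1-homo-*)
  open import Algebra.Properties.Ring ring using (-0#≈0#; -‿distribˡ-*; -‿distribʳ-*)
  open import Algebra.Properties.AbelianGroup +-abelianGroup using (⁻¹-∙-comm)
  open import Algebra.Properties.Group +-group using (⁻¹-involutive)
  open import Algebra.Properties.CommutativeSemigroup +-commutativeSemigroup using (interchange)
  open import Algebra.Solver.Ring.AlmostCommutativeRing
    using (AlmostCommutativeRing; fromCommutativeRing; _-Raw-AlmostCommutative⟶_)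

  -- This _×_ has 1 × x = x definitionally, so the solver's constant 1 is literally 1#.
  fromℤ : ℤ → Carrier
  fromℤ (+ n)    = n × 1#
  fromℤ -[1+ n ] = - (suc n × 1#)

  [1+x]-[1+y]≈x-y : ∀ x y → (1# + x) - (1# + y) ≈ x - y
  [1+x]-[1+y]≈x-y x y = begin
    (1# + x) + - (1# + y)   ≈⟨ +-congˡ (⁻¹-∙-comm 1# y) ⟨
    (1# + x) + (- 1# + - y) ≈⟨ interchange 1# x (- 1#) (- y) ⟩
    (1# - 1#) + (x - y)     ≈⟨ +-congʳ (-‿inverseʳ 1#) ⟩
    0# + (x - y)            ≈⟨ +-identityˡ _ ⟩
    x - y                   ∎

  fromℤ-⊖ : ∀ m n → fromℤ (m ⊖ n) ≈ m × 1# - n × 1#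
  fromℤ-⊖ zero    zero    = sym (-‿inverseʳ 0#)
  fromℤ-⊖ (suc m) zero    = sym (trans (+-congˡ -0#≈0#) (+-identityʳ _))
  fromℤ-⊖ zero    (suc n) = sym (+-identityˡ _)
  fromℤ-⊖ (suc m) (suc n) = begin
    fromℤ (suc m ⊖ suc n)         ≡⟨ ≡.cong fromℤ (ℤ.[1+m]⊖[1+n]≡m⊖n m n) ⟩
    fromℤ (m ⊖ n)                 ≈⟨ fromℤ-⊖ m n ⟩
    m × 1# - n × 1#               ≈⟨ [1+x]-[1+y]≈x-y (m × 1#) (n × 1#) ⟨
    (1# + m × 1#) - (1# + n × 1#) ≈⟨ +-cong (1+× m 1#) (-‿cong (1+× n 1#)) ⟨
    suc m × 1# - suc n × 1#       ∎

  fromℤ-+ : ∀ i j → fromℤ (i ℤ.+ j) ≈ fromℤ i + fromℤ j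
  fromℤ-+ (+ m)    (+ n)    = ×-homo-+ 1# m n
  fromℤ-+ (+ m)    -[1+ n ] = fromℤ-⊖ m (suc n)
  fromℤ-+ -[1+ m ] (+ n)    = trans (fromℤ-⊖ n (suc m)) (+-comm _ _)
  fromℤ-+ -[1+ m ] -[1+ n ] = begin
    - (suc (suc (m ℕ.+ n)) × 1#)     ≡⟨ ≡.cong (λ k → - (suc k × 1#)) (ℕ.+-suc m n) ⟨
    - ((suc m ℕ.+ suc n) × 1#)       ≈⟨ -‿cong (×-homo-+ 1# (suc m) (suc n)) ⟩
    - (suc m × 1# + suc n × 1#)      ≈⟨ ⁻¹-∙-comm _ _ ⟨
    - (suc m × 1#) + - (suc n × 1#)  ∎

  fromℤ-neg : ∀ i → fromℤ (ℤ.- i) ≈ - fromℤ i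
  fromℤ-neg (+ zero)  = sym -0#≈0#
  fromℤ-neg (+ suc n) = refl
  fromℤ-neg -[1+ n ]  = sym (⁻¹-involutive _)

  signed : Sign → Carrier → Carrier
  signed Sign.+ x = x
  signed Sign.- x = - x

  signed-cong : ∀ s {x y} → x ≈ y → signed s x ≈ signed s y
  signed-cong Sign.+ x≈y = x≈y
  signed-cong Sign.- x≈y = -‿cong x≈y

  signed-* : ∀ s t x y → signed (s Sign.* t) (x * y) ≈ signed s x * signed t y
  signed-* Sign.+ Sign.+ x y = refl
  signed-* Sign.+ Sign.- x y = -‿distribʳ-* x y
  signed-* Sign.- Sign.+ x y = -‿distribˡ-* x y
  signed-* Sign.- Sign.- x y = begin
    x * y             ≈⟨ ⁻¹-involutive _ ⟨
    - - (x * y)       ≈⟨ -‿cong (-‿distribˡ-* x y) ⟩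
    - (- x * y)       ≈⟨ -‿distribʳ-* (- x) y ⟩
    - x * - y         ∎

  fromℤ-◃ : ∀ s n → fromℤ (s ◃ n) ≈ signed s (n × 1#)
  fromℤ-◃ Sign.+ zero    = refl
  fromℤ-◃ Sign.- zero    = sym -0#≈0#
  fromℤ-◃ Sign.+ (suc n) = refl
  fromℤ-◃ Sign.- (suc n) = refl

  fromℤ≈signed : ∀ i → fromℤ i ≈ signed (sign i) (∣ i ∣ × 1#)
  fromℤ≈signed (+ n)    = refl
  fromℤ≈signed -[1+ n ] = refl

  fromℤ-* : ∀ i j → fromℤ (i ℤ.* j) ≈ fromℤ i * fromℤ j
  fromℤ-* i j = begin
    fromℤ (s ◃ ∣ i ∣ ℕ.* ∣ j ∣)                                 ≈⟨ fromℤ-◃ s (∣ i ∣ ℕ.* ∣ j ∣) ⟩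
    signed s ((∣ i ∣ ℕ.* ∣ j ∣) × 1#)                            ≈⟨ signed-cong s (×1-homo-* ∣ i ∣ ∣ j ∣) ⟩
    signed s (∣ i ∣ × 1# * ∣ j ∣ × 1#)                           ≈⟨ signed-* (sign i) (sign j) _ _ ⟩
    signed (sign i) (∣ i ∣ × 1#) * signed (sign j) (∣ j ∣ × 1#)  ≈⟨ *-cong (fromℤ≈signed i) (fromℤ≈signed j) ⟨
    fromℤ i * fromℤ j                                            ∎
    where
    s : Sign
    s = sign i Sign.* sign j

  almostCommutativeRing : AlmostCommutativeRing c ℓ
  almostCommutativeRing = fromCommutativeRing R

  fromℤ-homomorphism : ℤ.+-*-rawRing -Raw-AlmostCommutative⟶ almostCommutativeRing
  fromℤ-homomorphism = record
    { ⟦_⟧ = fromℤ ; +-homo = fromℤ-+ ; *-homo = fromℤ-* ; -‿homo = fromℤ-neg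
    ; 0-homo = refl ; 1-homo = refl }

  fromℤ-≟ : ∀ i j → Maybe (fromℤ i ≈ fromℤ j)
  fromℤ-≟ i j with i ℤ.≟ j
  ... | yes ≡.refl = just refl
  ... | no _       = nothing

  open import Algebra.Solver.Ring ℤ.+-*-rawRing almostCommutativeRing fromℤ-homomorphism fromℤ-≟ public

-- Kept generic so that the same formulas can be instantiated at ring-solver
-- polynomials, letting identities about them be discharged by solve.
module Formulas {c ℓ} (R : RawRing c ℓ) where
  open RawRing R
  open import Data.Product using (_×_)

  private
    infixl 6 _-_
    _-_ : Carrier → Carrier → Carrier
    x - y = x + - y

  Vec₃ : Set c
  Vec₃ = Carrier × Carrier × Carrier

  det : Vec₃ → Vec₃ → Vec₃ → Carrier
  det (a₁ , a₂ , a₃) (b₁ , b₂ , b₃) (d₁ , d₂ , d₃) =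
    (a₁ * ((b₂ * d₃) - (b₃ * d₂)) - a₂ * ((b₁ * d₃) - (b₃ * d₁)))
      + a₃ * ((b₁ * d₂) - (b₂ * d₁))

  dot : Vec₃ → Vec₃ → Carrier
  dot (a₁ , a₂ , a₃) (b₁ , b₂ , b₃) = ((a₁ * b₁) + (a₂ * b₂)) + (a₃ * b₃)

  apply : Vec₃ × Vec₃ × Vec₃ → Vec₃ → Vec₃
  apply (r₁ , r₂ , r₃) v = dot r₁ v , dot r₂ v , dot r₃ v

  cross : Vec₃ → Vec₃ → Vec₃
  cross (u₁ , u₂ , u₃) (w₁ , w₂ , w₃) =
    u₂ * w₃ - u₃ * w₂ , u₃ * w₁ - u₁ * w₃ , u₁ * w₂ - u₂ * w₁

  adjugate : Vec₃ × Vec₃ × Vec₃ → Vec₃ → Vec₃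
  adjugate ((a , b , d) , (e , f , g) , (h , i , j)) (v₁ , v₂ , v₃) =
      v₁ * (f * j - g * i) + v₂ * (d * i - b * j) + v₃ * (b * g - d * f)
    , v₁ * (g * h - e * j) + v₂ * (a * j - d * h) + v₃ * (d * e - a * g)
    , v₁ * (e * i - f * h) + v₂ * (b * h - a * i) + v₃ * (a * f - b * e)

module Plane {c ℓ} (F : Field c ℓ) where
  open Field F
  open PG F
  open import Data.Product using (_×_)
  open import Relation.Binary.Reasoning.Setoid setoid
  open IntegerCoefficients commutativeRing using (Polynomial; con; _:+_; _:*_; _:-_; :-_; _:=_; solve)
  open import Algebra.Properties.Ring ring using (-0#≈0#; [y-z]x≈yx-zx)
  open import Algebra.Properties.Group +-group
    using (⁻¹-involutive; x∙y⁻¹≈ε⇒x≈y; x≈y⇒x∙y⁻¹≈ε; inverseʳ-unique; identityʳ-unique)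

  1≉0 : 1# ≉ 0#
  1≉0 1≈0 = 0≉1 (sym 1≈0)

  -‿≉0 : ∀ {x} → x ≉ 0# → - x ≉ 0#
  -‿≉0 {x} x≉0 -x≈0 = x≉0 (trans (sym (⁻¹-involutive x)) (trans (-‿cong -x≈0) -0#≈0#))

  x≈1⇒x≉0 : ∀ {x} → x ≈ 1# → x ≉ 0#
  x≈1⇒x≉0 x≈1 x≈0 = 1≉0 (trans (sym x≈1) x≈0)

  x≈-1⇒x≉0 : ∀ {x} → x ≈ - 1# → x ≉ 0#
  x≈-1⇒x≉0 x≈-1 x≈0 = -‿≉0 1≉0 (trans (sym x≈-1) x≈0)

  inv : ∀ x → x ≉ 0# → Carrier
  inv x x≉0 = proj₁ (inverse x x≉0)

  x*inv≈1 : ∀ x (x≉0 : x ≉ 0#) → x * inv x x≉0 ≈ 1#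
  x*inv≈1 x x≉0 = proj₂ (inverse x x≉0)

  y≈0⇒x*y≈0 : ∀ {x y} → y ≈ 0# → x * y ≈ 0#
  y≈0⇒x*y≈0 y≈0 = trans (*-congˡ y≈0) (zeroʳ _)

  x-y≈0⇒x≈y : ∀ {x y} → x - y ≈ 0# → x ≈ y
  x-y≈0⇒x≈y = x∙y⁻¹≈ε⇒x≈y _ _

  x≈0⇒x≈y*0 : ∀ {x} y → x ≈ 0# → x ≈ y * 0#
  x≈0⇒x≈y*0 y x≈0 = trans x≈0 (sym (zeroʳ y))

  x*y≈0⇒y≈0 : ∀ {x y} → x ≉ 0# → x * y ≈ 0# → y ≈ 0#
  x*y≈0⇒y≈0 {x} {y} x≉0 xy≈0 = begin
    y                    ≈⟨ *-identityˡ y ⟨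
    1# * y               ≈⟨ *-congʳ (trans (*-comm _ x) (x*inv≈1 x x≉0)) ⟨
    (inv x x≉0 * x) * y  ≈⟨ *-assoc _ x y ⟩
    inv x x≉0 * (x * y)  ≈⟨ y≈0⇒x*y≈0 xy≈0 ⟩
    0#                   ∎

  *-≉0 : ∀ {x y} → x ≉ 0# → y ≉ 0# → x * y ≉ 0#
  *-≉0 x≉0 y≉0 xy≈0 = y≉0 (x*y≈0⇒y≈0 x≉0 xy≈0)

  inv≉0 : ∀ x (x≉0 : x ≉ 0#) → inv x x≉0 ≉ 0#
  inv≉0 x x≉0 inv≈0 = 1≉0 (trans (sym (x*inv≈1 x x≉0)) (y≈0⇒x*y≈0 inv≈0))

  *-cancelˡ : ∀ {x y z} → x ≉ 0# → x * y ≈ x * z → y ≈ z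
  *-cancelˡ {x} {y} {z} x≉0 xy≈xz = x∙y⁻¹≈ε⇒x≈y y z (x*y≈0⇒y≈0 x≉0
    (trans (distrib-sub x y z) (x≈y⇒x∙y⁻¹≈ε xy≈xz)))
    where
    distrib-sub : ∀ x y z → x * (y - z) ≈ x * y - x * z
    distrib-sub = solve 3 (λ x y z → x :* (y :- z) := x :* y :- x :* z) refl

  -- Vectors and projective equality

  ≈₃-refl : ∀ {u} → u ≈₃ u
  ≈₃-refl = refl , refl , refl

  ≈₃-sym : ∀ {u v} → u ≈₃ v → v ≈₃ u
  ≈₃-sym (e₁ , e₂ , e₃) = sym e₁ , sym e₂ , sym e₃

  ≈₃-trans : ∀ {u v w} → u ≈₃ v → v ≈₃ w → u ≈₃ w
  ≈₃-trans (e₁ , e₂ , e₃) (f₁ , f₂ , f₃) = trans e₁ f₁ , trans e₂ f₂ , trans e₃ f₃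

  ·₃-cong : ∀ {k k' u v} → k ≈ k' → u ≈₃ v → (k ·₃ u) ≈₃ (k' ·₃ v)
  ·₃-cong k≈k' (e₁ , e₂ , e₃) = *-cong k≈k' e₁ , *-cong k≈k' e₂ , *-cong k≈k' e₃

  ·₃-assoc : ∀ k k' u → (k ·₃ (k' ·₃ u)) ≈₃ ((k * k') ·₃ u)
  ·₃-assoc k k' (a , b , d) = sym (*-assoc k k' a) , sym (*-assoc k k' b) , sym (*-assoc k k' d)

  ·₃-identity : ∀ u → (1# ·₃ u) ≈₃ u
  ·₃-identity (a , b , d) = *-identityˡ a , *-identityˡ b , *-identityˡ d

  ·₃-zero : ∀ u → (0# ·₃ u) ≈₃ 0₃
  ·₃-zero (a , b , d) = zeroˡ a , zeroˡ b , zeroˡ d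

  ·₃-cancel : ∀ {k u v} → k ≉ 0# → (k ·₃ u) ≈₃ (k ·₃ v) → u ≈₃ v
  ·₃-cancel k≉0 (e₁ , e₂ , e₃) = *-cancelˡ k≉0 e₁ , *-cancelˡ k≉0 e₂ , *-cancelˡ k≉0 e₃

  ·₃≈0₃⇒≈0₃ : ∀ {k u} → k ≉ 0# → (k ·₃ u) ≈₃ 0₃ → u ≈₃ 0₃
  ·₃≈0₃⇒≈0₃ k≉0 (e₁ , e₂ , e₃) = x*y≈0⇒y≈0 k≉0 e₁ , x*y≈0⇒y≈0 k≉0 e₂ , x*y≈0⇒y≈0 k≉0 e₃

  ≈₃⇒∼ᵥ : ∀ {u v} → u ≈₃ v → u ∼ᵥ v
  ≈₃⇒∼ᵥ {v = v} u≈v = 1# , 1≉0 , ≈₃-trans u≈v (≈₃-sym (·₃-identity v))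

  ∼ᵥ-refl : ∀ {u} → u ∼ᵥ u
  ∼ᵥ-refl = ≈₃⇒∼ᵥ ≈₃-refl

  ∼ᵥ-sym : ∀ {u v} → u ∼ᵥ v → v ∼ᵥ u
  ∼ᵥ-sym {u} {v} (k , k≉0 , u≈kv) = k⁻¹ , inv≉0 k k≉0 , v≈k⁻¹u
    where
    k⁻¹ : Carrier
    k⁻¹ = inv k k≉0
    v≈k⁻¹u : v ≈₃ (k⁻¹ ·₃ u)
    v≈k⁻¹u = ≈₃-trans (≈₃-sym (·₃-identity v))
               (≈₃-trans (·₃-cong (trans (sym (x*inv≈1 k k≉0)) (*-comm k k⁻¹)) ≈₃-refl)
                 (≈₃-trans (≈₃-sym (·₃-assoc k⁻¹ k v)) (·₃-cong refl (≈₃-sym u≈kv))))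

  ∼ᵥ-trans : ∀ {u v w} → u ∼ᵥ v → v ∼ᵥ w → u ∼ᵥ w
  ∼ᵥ-trans {w = w} (k , k≉0 , u≈kv) (l , l≉0 , v≈lw) =
    k * l , *-≉0 k≉0 l≉0 , ≈₃-trans u≈kv (≈₃-trans (·₃-cong refl v≈lw) (·₃-assoc k l w))

  -- Determinants and matrices

  0ₚ 1ₚ : ∀ {n} → Polynomial n
  0ₚ = con (+ 0)
  1ₚ = con (+ 1)

  polynomialRawRing : ℕ → RawRing _ _
  polynomialRawRing n = record
    { Carrier = Polynomial n ; _≈_ = _≡_ ; _+_ = _:+_ ; _*_ = _:*_ ; -_ = :-_ ; 0# = 0ₚ ; 1# = 1ₚ }

  module _ {n : ℕ} where
    open Formulas (polynomialRawRing n) public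
      using () renaming (Vec₃ to Vec₃ₚ; det to detₚ; dot to dotₚ; apply to applyₚ; cross to crossₚ; adjugate to adjugateₚ)

  open Formulas rawRing using (cross; adjugate)

  det-cong : ∀ {u u' v v' w w'} → u ≈₃ u' → v ≈₃ v' → w ≈₃ w' → det u v w ≈ det u' v' w'
  det-cong (a₁ , a₂ , a₃) (b₁ , b₂ , b₃) (d₁ , d₂ , d₃) =
    +-cong (+-cong (*-cong a₁ (+-cong (*-cong b₂ d₃) (-‿cong (*-cong b₃ d₂))))
                   (-‿cong (*-cong a₂ (+-cong (*-cong b₁ d₃) (-‿cong (*-cong b₃ d₁))))))
           (*-cong a₃ (+-cong (*-cong b₁ d₂) (-‿cong (*-cong b₂ d₁))))

  det-·₃ : ∀ k l m u v w → det (k ·₃ u) (l ·₃ v) (m ·₃ w) ≈ (k * (l * m)) * det u v w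
  det-·₃ k l m (a₁ , a₂ , a₃) (b₁ , b₂ , b₃) (d₁ , d₂ , d₃) =
    solve 12 (λ k l m a₁ a₂ a₃ b₁ b₂ b₃ d₁ d₂ d₃ →
      detₚ (k :* a₁ , k :* a₂ , k :* a₃) (l :* b₁ , l :* b₂ , l :* b₃) (m :* d₁ , m :* d₂ , m :* d₃)
      := (k :* (l :* m)) :* detₚ (a₁ , a₂ , a₃) (b₁ , b₂ , b₃) (d₁ , d₂ , d₃))
      refl k l m a₁ a₂ a₃ b₁ b₂ b₃ d₁ d₂ d₃

  det≈0-resp-∼ᵥ : ∀ {u v w u' v' w'} → u ∼ᵥ u' → v ∼ᵥ v' → w ∼ᵥ w' →
                  det u' v' w' ≈ 0# → det u v w ≈ 0#
  det≈0-resp-∼ᵥ {u' = u'} {v'} {w'} (k , _ , u≈ku') (l , _ , v≈lv') (m , _ , w≈mw') det≈0 = begin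
    _                                   ≈⟨ det-cong u≈ku' v≈lv' w≈mw' ⟩
    det (k ·₃ u') (l ·₃ v') (m ·₃ w')   ≈⟨ det-·₃ k l m u' v' w' ⟩
    (k * (l * m)) * det u' v' w'        ≈⟨ y≈0⇒x*y≈0 det≈0 ⟩
    0#                                  ∎

  det-cyclic : ∀ u v w → det u v w ≈ det v w u
  det-cyclic (a₁ , a₂ , a₃) (b₁ , b₂ , b₃) (d₁ , d₂ , d₃) =
    solve 9 (λ a₁ a₂ a₃ b₁ b₂ b₃ d₁ d₂ d₃ →
      detₚ (a₁ , a₂ , a₃) (b₁ , b₂ , b₃) (d₁ , d₂ , d₃) := detₚ (b₁ , b₂ , b₃) (d₁ , d₂ , d₃) (a₁ , a₂ , a₃))
      refl a₁ a₂ a₃ b₁ b₂ b₃ d₁ d₂ d₃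

  det-swap : ∀ u v w → det u v w ≈ - det u w v
  det-swap (a₁ , a₂ , a₃) (b₁ , b₂ , b₃) (d₁ , d₂ , d₃) =
    solve 9 (λ a₁ a₂ a₃ b₁ b₂ b₃ d₁ d₂ d₃ →
      detₚ (a₁ , a₂ , a₃) (b₁ , b₂ , b₃) (d₁ , d₂ , d₃) := :- detₚ (a₁ , a₂ , a₃) (d₁ , d₂ , d₃) (b₁ , b₂ , b₃))
      refl a₁ a₂ a₃ b₁ b₂ b₃ d₁ d₂ d₃

  det-repeat₁₂ : ∀ u v → det u u v ≈ 0#
  det-repeat₁₂ (a₁ , a₂ , a₃) (b₁ , b₂ , b₃) =
    solve 6 (λ a₁ a₂ a₃ b₁ b₂ b₃ → detₚ (a₁ , a₂ , a₃) (a₁ , a₂ , a₃) (b₁ , b₂ , b₃) := 0ₚ)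
      refl a₁ a₂ a₃ b₁ b₂ b₃

  det-repeat₂₃ : ∀ u v → det u v v ≈ 0#
  det-repeat₂₃ u v = trans (det-cyclic u v v) (det-repeat₁₂ v u)

  det-repeat₁₃ : ∀ u v → det u v u ≈ 0#
  det-repeat₁₃ u v = trans (det-cyclic u v u) (det-repeat₂₃ v u)

  dot-cong : ∀ r {u v} → u ≈₃ v → dot r u ≈ dot r v
  dot-cong r (e₁ , e₂ , e₃) = +-cong (+-cong (*-congˡ e₁) (*-congˡ e₂)) (*-congˡ e₃)

  apply-cong : ∀ M {u v} → u ≈₃ v → apply M u ≈₃ apply M v
  apply-cong (r₁ , r₂ , r₃) u≈v = dot-cong r₁ u≈v , dot-cong r₂ u≈v , dot-cong r₃ u≈v

  dot-·₃ʳ : ∀ r k u → dot r (k ·₃ u) ≈ k * dot r u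
  dot-·₃ʳ (a , b , d) k (x , y , z) =
    solve 7 (λ a b d k x y z → dotₚ (a , b , d) (k :* x , k :* y , k :* z) := k :* dotₚ (a , b , d) (x , y , z))
      refl a b d k x y z

  dot-·₃ˡ : ∀ k r u → dot (k ·₃ r) u ≈ k * dot r u
  dot-·₃ˡ k (a , b , d) (x , y , z) =
    solve 7 (λ a b d k x y z → dotₚ (k :* a , k :* b , k :* d) (x , y , z) := k :* dotₚ (a , b , d) (x , y , z))
      refl a b d k x y z

  apply-·₃ : ∀ M k u → apply M (k ·₃ u) ≈₃ (k ·₃ apply M u)
  apply-·₃ (r₁ , r₂ , r₃) k u = dot-·₃ʳ r₁ k u , dot-·₃ʳ r₂ k u , dot-·₃ʳ r₃ k u

  dot-cross : ∀ u w v → dot (cross u w) v ≈ det u w v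
  dot-cross (a₁ , a₂ , a₃) (b₁ , b₂ , b₃) (v₁ , v₂ , v₃) =
    solve 9 (λ a₁ a₂ a₃ b₁ b₂ b₃ v₁ v₂ v₃ →
      dotₚ (crossₚ (a₁ , a₂ , a₃) (b₁ , b₂ , b₃)) (v₁ , v₂ , v₃) := detₚ (a₁ , a₂ , a₃) (b₁ , b₂ , b₃) (v₁ , v₂ , v₃))
      refl a₁ a₂ a₃ b₁ b₂ b₃ v₁ v₂ v₃

  det-apply : ∀ M u v w → det (apply M u) (apply M v) (apply M w) ≈ detM M * det u v w
  det-apply ((a , b , d) , (e , f , g) , (h , i , j)) (u₁ , u₂ , u₃) (v₁ , v₂ , v₃) (w₁ , w₂ , w₃) =
    solve 18 (λ a b d e f g h i j u₁ u₂ u₃ v₁ v₂ v₃ w₁ w₂ w₃ →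
      detₚ (applyₚ ((a , b , d) , (e , f , g) , (h , i , j)) (u₁ , u₂ , u₃))
           (applyₚ ((a , b , d) , (e , f , g) , (h , i , j)) (v₁ , v₂ , v₃))
           (applyₚ ((a , b , d) , (e , f , g) , (h , i , j)) (w₁ , w₂ , w₃))
      := detₚ (a , b , d) (e , f , g) (h , i , j) :* detₚ (u₁ , u₂ , u₃) (v₁ , v₂ , v₃) (w₁ , w₂ , w₃))
      refl a b d e f g h i j u₁ u₂ u₃ v₁ v₂ v₃ w₁ w₂ w₃

  adjugate-cong : ∀ M {u v} → u ≈₃ v → adjugate M u ≈₃ adjugate M v
  adjugate-cong ((a , b , d) , (e , f , g) , (h , i , j)) {u₁ , u₂ , u₃} {v₁ , v₂ , v₃} (e₁ , e₂ , e₃) =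
    combination , combination , combination
    where
    combination : ∀ {x y z} → u₁ * x + u₂ * y + u₃ * z ≈ v₁ * x + v₂ * y + v₃ * z
    combination = +-cong (+-cong (*-congʳ e₁) (*-congʳ e₂)) (*-congʳ e₃)

  apply-adjugate : ∀ M v → apply M (adjugate M v) ≈₃ (detM M ·₃ v)
  apply-adjugate ((a , b , d) , (e , f , g) , (h , i , j)) (v₁ , v₂ , v₃) =
      solve 12 (λ a b d e f g h i j v₁ v₂ v₃ →
        proj₁ (lhs a b d e f g h i j v₁ v₂ v₃) := Δ a b d e f g h i j :* v₁)
        refl a b d e f g h i j v₁ v₂ v₃
    , solve 12 (λ a b d e f g h i j v₁ v₂ v₃ →
        proj₁ (proj₂ (lhs a b d e f g h i j v₁ v₂ v₃)) := Δ a b d e f g h i j :* v₂)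
        refl a b d e f g h i j v₁ v₂ v₃
    , solve 12 (λ a b d e f g h i j v₁ v₂ v₃ →
        proj₂ (proj₂ (lhs a b d e f g h i j v₁ v₂ v₃)) := Δ a b d e f g h i j :* v₃)
        refl a b d e f g h i j v₁ v₂ v₃
    where
    Δ : ∀ {n} (a b d e f g h i j : Polynomial n) → Polynomial n
    Δ a b d e f g h i j = detₚ (a , b , d) (e , f , g) (h , i , j)
    lhs : ∀ {n} (a b d e f g h i j v₁ v₂ v₃ : Polynomial n) → Vec₃ₚ
    lhs a b d e f g h i j v₁ v₂ v₃ =
      let Mₚ = (a , b , d) , (e , f , g) , (h , i , j) in applyₚ Mₚ (adjugateₚ Mₚ (v₁ , v₂ , v₃))

  adjugate-apply : ∀ M u → adjugate M (apply M u) ≈₃ (detM M ·₃ u)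
  adjugate-apply ((a , b , d) , (e , f , g) , (h , i , j)) (u₁ , u₂ , u₃) =
      solve 12 (λ a b d e f g h i j u₁ u₂ u₃ →
        proj₁ (lhs a b d e f g h i j u₁ u₂ u₃) := Δ a b d e f g h i j :* u₁)
        refl a b d e f g h i j u₁ u₂ u₃
    , solve 12 (λ a b d e f g h i j u₁ u₂ u₃ →
        proj₁ (proj₂ (lhs a b d e f g h i j u₁ u₂ u₃)) := Δ a b d e f g h i j :* u₂)
        refl a b d e f g h i j u₁ u₂ u₃
    , solve 12 (λ a b d e f g h i j u₁ u₂ u₃ →
        proj₂ (proj₂ (lhs a b d e f g h i j u₁ u₂ u₃)) := Δ a b d e f g h i j :* u₃)
        refl a b d e f g h i j u₁ u₂ u₃
    where
    Δ : ∀ {n} (a b d e f g h i j : Polynomial n) → Polynomial n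
    Δ a b d e f g h i j = detₚ (a , b , d) (e , f , g) (h , i , j)
    lhs : ∀ {n} (a b d e f g h i j u₁ u₂ u₃ : Polynomial n) → Vec₃ₚ
    lhs a b d e f g h i j u₁ u₂ u₃ =
      let Mₚ = (a , b , d) , (e , f , g) , (h , i , j) in adjugateₚ Mₚ (applyₚ Mₚ (u₁ , u₂ , u₃))

  apply-0₃ : ∀ M → apply M 0₃ ≈₃ 0₃
  apply-0₃ M = ≈₃-trans (apply-cong M (≈₃-sym (·₃-zero 0₃))) (≈₃-trans (apply-·₃ M 0# 0₃) (·₃-zero _))

  module Collineation (M : M3) (detM≉0 : detM M ≉ 0#) where

    apply-injective : ∀ {u w} k → apply M u ≈₃ (k ·₃ apply M w) → u ≈₃ (k ·₃ w)
    apply-injective {u} {w} k Mu≈kMw = ·₃-cancel detM≉0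
      (≈₃-trans (≈₃-sym (adjugate-apply M u))
        (≈₃-trans (adjugate-cong M (≈₃-trans Mu≈kMw (≈₃-sym (apply-·₃ M k w))))
          (adjugate-apply M (k ·₃ w))))

    apply-≉0₃ : ∀ {u} → ¬ (u ≈₃ 0₃) → ¬ (apply M u ≈₃ 0₃)
    apply-≉0₃ {u} u≉0 Mu≈0 =
      u≉0 (≈₃-trans (apply-injective 0# (≈₃-trans Mu≈0 (≈₃-sym (·₃-zero _)))) (·₃-zero u))

    apply-∼ᵥ : ∀ {u w} → u ∼ᵥ w → apply M u ∼ᵥ apply M w
    apply-∼ᵥ {w = w} (k , k≉0 , u≈kw) = k , k≉0 , ≈₃-trans (apply-cong M u≈kw) (apply-·₃ M k w)

    apply-∼ᵥ⁻¹ : ∀ {u w} → apply M u ∼ᵥ apply M w → u ∼ᵥ w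
    apply-∼ᵥ⁻¹ (k , k≉0 , Mu≈kMw) = k , k≉0 , apply-injective k Mu≈kMw

    apply-det≈0 : ∀ {u v w} → det u v w ≈ 0# → det (apply M u) (apply M v) (apply M w) ≈ 0#
    apply-det≈0 {u} {v} {w} det≈0 = trans (det-apply M u v w) (y≈0⇒x*y≈0 det≈0)

    apply-det≈0⁻¹ : ∀ {u v w} → det (apply M u) (apply M v) (apply M w) ≈ 0# → det u v w ≈ 0#
    apply-det≈0⁻¹ {u} {v} {w} det≈0 = x*y≈0⇒y≈0 detM≉0 (trans (sym (det-apply M u v w)) det≈0)

    preimage : (t : V) → ¬ (t ≈₃ 0₃) → Σ Point λ Y → apply M (vec Y) ∼ᵥ t
    preimage t t≉0 = (adjugate M t , adjugate≉0) , detM M , detM≉0 , apply-adjugate M t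
      where
      adjugate≉0 : ¬ (adjugate M t ≈₃ 0₃)
      adjugate≉0 adj≈0 = t≉0 (·₃≈0₃⇒≈0₃ detM≉0
        (≈₃-trans (≈₃-sym (apply-adjugate M t)) (≈₃-trans (apply-cong M adj≈0) (apply-0₃ M))))

    -- A record rather than a synonym, so that X can be inferred from a proof of X ↦ t.
    record _↦_ (X : Point) (t : V) : Set (c ⊔ ℓ) where
      constructor mk↦
      field image∼ᵥ : apply M (vec X) ∼ᵥ t
    open _↦_ public

    ↦-self : ∀ X → X ↦ apply M (vec X)
    ↦-self X = mk↦ ∼ᵥ-refl

    ↦-resp-∼ : ∀ {X Y t} → X ∼ Y → Y ↦ t → X ↦ t
    ↦-resp-∼ X∼Y (mk↦ Y↦t) = mk↦ (∼ᵥ-trans (apply-∼ᵥ X∼Y) Y↦t)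

    ↦-∼ : ∀ {X Y s t} → X ↦ s → Y ↦ t → X ∼ Y → s ∼ᵥ t
    ↦-∼ (mk↦ X↦s) (mk↦ Y↦t) X∼Y = ∼ᵥ-trans (∼ᵥ-sym X↦s) (∼ᵥ-trans (apply-∼ᵥ X∼Y) Y↦t)

    ↦-∼⁻¹ : ∀ {X Y s t} → X ↦ s → Y ↦ t → s ∼ᵥ t → X ∼ Y
    ↦-∼⁻¹ (mk↦ X↦s) (mk↦ Y↦t) s∼t = apply-∼ᵥ⁻¹ (∼ᵥ-trans X↦s (∼ᵥ-trans s∼t (∼ᵥ-sym Y↦t)))

    ↦-collinear : ∀ {X Y Z s t u} → X ↦ s → Y ↦ t → Z ↦ u → Collinear X Y Z → det s t u ≈ 0#
    ↦-collinear (mk↦ X↦s) (mk↦ Y↦t) (mk↦ Z↦u) XYZ =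
      det≈0-resp-∼ᵥ (∼ᵥ-sym X↦s) (∼ᵥ-sym Y↦t) (∼ᵥ-sym Z↦u) (apply-det≈0 XYZ)

    ↦-collinear⁻¹ : ∀ {X Y Z s t u} → X ↦ s → Y ↦ t → Z ↦ u → det s t u ≈ 0# → Collinear X Y Z
    ↦-collinear⁻¹ (mk↦ X↦s) (mk↦ Y↦t) (mk↦ Z↦u) stu = apply-det≈0⁻¹ (det≈0-resp-∼ᵥ X↦s Y↦t Z↦u stu)

  e₁₂ : V
  e₁₂ = 1# , 1# , 0#

  det-e₁e₂e₃ : det e₁ e₂ e₃ ≈ 1#
  det-e₁e₂e₃ = solve 0 (detₚ (1ₚ , 0ₚ , 0ₚ) (0ₚ , 1ₚ , 0ₚ) (0ₚ , 0ₚ , 1ₚ) := 1ₚ) refl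

  det-e₁e₂ : ∀ x₁ x₂ x₃ → det e₁ e₂ (x₁ , x₂ , x₃) ≈ x₃
  det-e₁e₂ = solve 3 (λ x₁ x₂ x₃ → detₚ (1ₚ , 0ₚ , 0ₚ) (0ₚ , 1ₚ , 0ₚ) (x₁ , x₂ , x₃) := x₃) refl

  det-e₃e₁₂₃ : ∀ x₁ x₂ x₃ → det e₃ e₁₂₃ (x₁ , x₂ , x₃) ≈ x₂ - x₁
  det-e₃e₁₂₃ = solve 3 (λ x₁ x₂ x₃ → detₚ (0ₚ , 0ₚ , 1ₚ) (1ₚ , 1ₚ , 1ₚ) (x₁ , x₂ , x₃) := x₂ :- x₁) refl

  Normalises : M3 → Point → Point → Point → Point → Set (c ⊔ ℓ)
  Normalises M A B C D = ¬ (detM M ≈ 0#)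
    × (apply M (vec A) ∼ᵥ e₁) × (apply M (vec B) ∼ᵥ e₂)
    × (apply M (vec C) ∼ᵥ e₃) × (apply M (vec D) ∼ᵥ e₁₂₃)

  crossMatrix : V → V → V → M3
  crossMatrix a b d = cross b d , cross d a , cross a b

  apply-crossMatrix : ∀ a b d v → apply (crossMatrix a b d) v ≈₃ (det v b d , det a v d , det a b v)
  apply-crossMatrix a b d v =
      trans (dot-cross b d v) (sym (det-cyclic v b d))
    , trans (dot-cross d a v) (sym (trans (det-cyclic a v d) (det-cyclic v d a)))
    , dot-cross a b v

  scaleRows : Carrier → Carrier → Carrier → M3 → M3
  scaleRows k₁ k₂ k₃ (r₁ , r₂ , r₃) = k₁ ·₃ r₁ , k₂ ·₃ r₂ , k₃ ·₃ r₃

  apply-scaleRows : ∀ k₁ k₂ k₃ r₁ r₂ r₃ v →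
    apply (scaleRows k₁ k₂ k₃ (r₁ , r₂ , r₃)) v ≈₃ (k₁ * dot r₁ v , k₂ * dot r₂ v , k₃ * dot r₃ v)
  apply-scaleRows k₁ k₂ k₃ r₁ r₂ r₃ v = dot-·₃ˡ k₁ r₁ v , dot-·₃ˡ k₂ r₂ v , dot-·₃ˡ k₃ r₃ v

  maps-to-basis⇒detM≉0 : ∀ M {a b d k₁ k₂ k₃} → k₁ ≉ 0# → k₂ ≉ 0# → k₃ ≉ 0# →
    apply M a ≈₃ (k₁ ·₃ e₁) → apply M b ≈₃ (k₂ ·₃ e₂) → apply M d ≈₃ (k₃ ·₃ e₃) → detM M ≉ 0#
  maps-to-basis⇒detM≉0 M {a} {b} {d} {k₁} {k₂} {k₃} k₁≉0 k₂≉0 k₃≉0 Ma Mb Md detM≈0 =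
    *-≉0 (*-≉0 k₁≉0 (*-≉0 k₂≉0 k₃≉0)) 1≉0 (begin
      (k₁ * (k₂ * k₃)) * 1#                      ≈⟨ *-congˡ det-e₁e₂e₃ ⟨
      (k₁ * (k₂ * k₃)) * det e₁ e₂ e₃            ≈⟨ det-·₃ k₁ k₂ k₃ e₁ e₂ e₃ ⟨
      det (k₁ ·₃ e₁) (k₂ ·₃ e₂) (k₃ ·₃ e₃)       ≈⟨ det-cong Ma Mb Md ⟨
      det (apply M a) (apply M b) (apply M d)    ≈⟨ det-apply M a b d ⟩
      detM M * det a b d                         ≈⟨ *-congʳ detM≈0 ⟩
      0# * det a b d                             ≈⟨ zeroˡ _ ⟩
      0#                                         ∎)

  frame-normalisable : ∀ A B C D → Frame A B C D → ∃ λ M → Normalises M A B C D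
  frame-normalisable A B C D (¬ABC , ¬ABD , ¬ACD , ¬BCD) =
    M₀ , maps-to-basis⇒detM≉0 M₀ k₁≉0 k₂≉0 k₃≉0 M₀a≈k₁e₁ M₀b≈k₂e₂ M₀d≈k₃e₃ ,
    (k₁ , k₁≉0 , M₀a≈k₁e₁) , (k₂ , k₂≉0 , M₀b≈k₂e₂) , (k₃ , k₃≉0 , M₀d≈k₃e₃) , (1# , 1≉0 , M₀g≈e₁₂₃)
    where
    a b d g : V
    a = vec A
    b = vec B
    d = vec C
    g = vec D
    α≉0 : det g b d ≉ 0#
    α≉0 α≈0 = ¬BCD (trans (sym (det-cyclic g b d)) α≈0)
    β≉0 : det a g d ≉ 0#
    β≉0 β≈0 = -‿≉0 ¬ACD (trans (sym (det-swap a g d)) β≈0)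
    α⁻¹ β⁻¹ γ⁻¹ k₁ k₂ k₃ : Carrier
    α⁻¹ = inv (det g b d) α≉0
    β⁻¹ = inv (det a g d) β≉0
    γ⁻¹ = inv (det a b g) ¬ABD
    k₁ = α⁻¹ * det a b d
    k₂ = β⁻¹ * det a b d
    k₃ = γ⁻¹ * det a b d
    k₁≉0 : k₁ ≉ 0#
    k₁≉0 = *-≉0 (inv≉0 _ α≉0) ¬ABC
    k₂≉0 : k₂ ≉ 0#
    k₂≉0 = *-≉0 (inv≉0 _ β≉0) ¬ABC
    k₃≉0 : k₃ ≉ 0#
    k₃≉0 = *-≉0 (inv≉0 _ ¬ABD) ¬ABC
    -- The rows b × d, d × a, a × b each kill two of a, b, d; the scalars make g ↦ (1,1,1).
    M₀ : M3
    M₀ = scaleRows α⁻¹ β⁻¹ γ⁻¹ (crossMatrix a b d)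
    apply-M₀ : ∀ v → apply M₀ v ≈₃ ((α⁻¹ * det v b d) , (β⁻¹ * det a v d) , (γ⁻¹ * det a b v))
    apply-M₀ v = ≈₃-trans (apply-scaleRows α⁻¹ β⁻¹ γ⁻¹ (cross b d) (cross d a) (cross a b) v)
      (*-congˡ (proj₁ rows) , *-congˡ (proj₁ (proj₂ rows)) , *-congˡ (proj₂ (proj₂ rows)))
      where
      rows : apply (crossMatrix a b d) v ≈₃ (det v b d , det a v d , det a b v)
      rows = apply-crossMatrix a b d v
    zero-entry : ∀ {x y} k → y ≈ 0# → x * y ≈ k * 0#
    zero-entry k y≈0 = x≈0⇒x≈y*0 k (y≈0⇒x*y≈0 y≈0)
    M₀a≈k₁e₁ : apply M₀ a ≈₃ (k₁ ·₃ e₁)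
    M₀a≈k₁e₁ = ≈₃-trans (apply-M₀ a)
      (sym (*-identityʳ k₁) , zero-entry k₁ (det-repeat₁₂ a d) , zero-entry k₁ (det-repeat₁₃ a b))
    M₀b≈k₂e₂ : apply M₀ b ≈₃ (k₂ ·₃ e₂)
    M₀b≈k₂e₂ = ≈₃-trans (apply-M₀ b)
      (zero-entry k₂ (det-repeat₁₂ b d) , sym (*-identityʳ k₂) , zero-entry k₂ (det-repeat₂₃ a b))
    M₀d≈k₃e₃ : apply M₀ d ≈₃ (k₃ ·₃ e₃)
    M₀d≈k₃e₃ = ≈₃-trans (apply-M₀ d)
      (zero-entry k₃ (det-repeat₁₃ d b) , zero-entry k₃ (det-repeat₂₃ a d) , sym (*-identityʳ k₃))
    x⁻¹*x≈1*1 : ∀ x (x≉0 : x ≉ 0#) → inv x x≉0 * x ≈ 1# * 1#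
    x⁻¹*x≈1*1 x x≉0 = trans (*-comm _ x) (trans (x*inv≈1 x x≉0) (sym (*-identityˡ 1#)))
    M₀g≈e₁₂₃ : apply M₀ g ≈₃ (1# ·₃ e₁₂₃)
    M₀g≈e₁₂₃ = ≈₃-trans (apply-M₀ g) (x⁻¹*x≈1*1 _ α≉0 , x⁻¹*x≈1*1 _ β≉0 , x⁻¹*x≈1*1 _ ¬ABD)

  -- The prime subfield

  𝔽ₚ : Carrier → Set ℓ
  𝔽ₚ = InPrimeField

  fromℕ-+ : ∀ m n → fromℕ (m ℕ.+ n) ≈ fromℕ m + fromℕ n
  fromℕ-+ zero    n = sym (+-identityˡ _)
  fromℕ-+ (suc m) n = trans (+-congˡ (fromℕ-+ m n)) (sym (+-assoc 1# (fromℕ m) (fromℕ n)))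

  fromℕ-* : ∀ m n → fromℕ (m ℕ.* n) ≈ fromℕ m * fromℕ n
  fromℕ-* zero    n = sym (zeroˡ _)
  fromℕ-* (suc m) n = begin
    fromℕ (n ℕ.+ m ℕ.* n)           ≈⟨ fromℕ-+ n (m ℕ.* n) ⟩
    fromℕ n + fromℕ (m ℕ.* n)       ≈⟨ +-cong (sym (*-identityˡ _)) (fromℕ-* m n) ⟩
    1# * fromℕ n + fromℕ m * fromℕ n ≈⟨ distribʳ (fromℕ n) 1# (fromℕ m) ⟨
    (1# + fromℕ m) * fromℕ n         ∎

  𝔽ₚ-0# : 𝔽ₚ 0#
  𝔽ₚ-0# = 0 , refl

  𝔽ₚ-1# : 𝔽ₚ 1#
  𝔽ₚ-1# = 1 , sym (+-identityʳ 1#)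

  𝔽ₚ-+ : ∀ {x y} → 𝔽ₚ x → 𝔽ₚ y → 𝔽ₚ (x + y)
  𝔽ₚ-+ (m , x≈m) (n , y≈n) = m ℕ.+ n , trans (+-cong x≈m y≈n) (sym (fromℕ-+ m n))

  𝔽ₚ-* : ∀ {x y} → 𝔽ₚ x → 𝔽ₚ y → 𝔽ₚ (x * y)
  𝔽ₚ-* (m , x≈m) (n , y≈n) = m ℕ.* n , trans (*-cong x≈m y≈n) (sym (fromℕ-* m n))

  InPrimeSubplane : V → Set (c ⊔ ℓ)
  InPrimeSubplane x = ∃ λ (w : V) → (x ∼ᵥ w)
    × 𝔽ₚ (proj₁ w) × 𝔽ₚ (proj₁ (proj₂ w)) × 𝔽ₚ (proj₂ (proj₂ w))

  module FiniteField (q : ℕ) (order : HasOrder F q) where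
    import Algebra.Properties.Semiring.Exp semiring as Exp

    enum : Fin q → Carrier
    enum = proj₁ order

    index : Carrier → Fin q
    index x = proj₁ (proj₁ (proj₂ order) x)

    enum-index : ∀ x → enum (index x) ≈ x
    enum-index x = proj₂ (proj₁ (proj₂ order) x)

    sequence-repeats : (f : ℕ → Carrier) → ∃ λ i → ∃ λ j → i ℕ.< j × f i ≈ f j
    sequence-repeats f with Fin.pigeonhole (ℕ.n<1+n q) (λ k → index (f (toℕ k)))
    ... | i , j , i<j , same-index =
      toℕ i , toℕ j , i<j , trans (sym (enum-index (f (toℕ i))))
        (trans (reflexive (≡.cong enum same-index)) (enum-index (f (toℕ j))))

    <⇒+suc : ∀ {i j} → i ℕ.< j → ∃ λ o → j ≡ i ℕ.+ suc o
    <⇒+suc {i} i<j with ℕ.m≤n⇒∃[o]m+o≡n i<j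
    ... | o , i+1+o≡j = o , ≡.trans (≡.sym i+1+o≡j) (≡.sym (ℕ.+-suc i o))

    positive-characteristic : ∃ λ N → fromℕ (suc N) ≈ 0#
    positive-characteristic with sequence-repeats fromℕ
    ... | i , j , i<j , fromℕi≈fromℕj with <⇒+suc i<j
    ... | o , ≡.refl = o , identityʳ-unique (fromℕ i) (fromℕ (suc o))
                             (trans (sym (fromℕ-+ i (suc o))) (sym fromℕi≈fromℕj))

    -- m + N m = (N + 1) m = 0.
    𝔽ₚ-neg : ∀ {x} → 𝔽ₚ x → 𝔽ₚ (- x)
    𝔽ₚ-neg {x} (m , x≈m) with positive-characteristic
    ... | N , char≈0 = N ℕ.* m , trans (-‿cong x≈m) (sym (inverseʳ-unique (fromℕ m) (fromℕ (N ℕ.* m))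
      (trans (sym (fromℕ-+ m (N ℕ.* m))) (trans (fromℕ-* (suc N) m) (trans (*-congʳ char≈0) (zeroˡ _))))))

    𝔽ₚ-sub : ∀ {x y} → 𝔽ₚ x → 𝔽ₚ y → 𝔽ₚ (x - y)
    𝔽ₚ-sub x∈𝔽ₚ y∈𝔽ₚ = 𝔽ₚ-+ x∈𝔽ₚ (𝔽ₚ-neg y∈𝔽ₚ)

    ^-≉0 : ∀ {x} → x ≉ 0# → ∀ n → x Exp.^ n ≉ 0#
    ^-≉0 x≉0 zero    = 1≉0
    ^-≉0 x≉0 (suc n) = *-≉0 x≉0 (^-≉0 x≉0 n)

    𝔽ₚ-^ : ∀ {x} → 𝔽ₚ x → ∀ n → 𝔽ₚ (x Exp.^ n)
    𝔽ₚ-^ x∈𝔽ₚ zero    = 𝔽ₚ-1#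
    𝔽ₚ-^ x∈𝔽ₚ (suc n) = 𝔽ₚ-* x∈𝔽ₚ (𝔽ₚ-^ x∈𝔽ₚ n)

    -- xⁱ = xⁱ⁺¹⁺ᵒ forces x xᵒ = 1.
    𝔽ₚ-inverse : ∀ {x} → 𝔽ₚ x → x ≉ 0# → ∃ λ y → 𝔽ₚ y × x * y ≈ 1#
    𝔽ₚ-inverse {x} x∈𝔽ₚ x≉0 with sequence-repeats (x Exp.^_)
    ... | i , j , i<j , xⁱ≈xʲ with <⇒+suc i<j
    ... | o , ≡.refl = x Exp.^ o , 𝔽ₚ-^ x∈𝔽ₚ o ,
      sym (*-cancelˡ (^-≉0 x≉0 i) (trans (*-identityʳ _) (trans xⁱ≈xʲ (Exp.^-homo-* x i (suc o)))))

    -- Points and lines of the 𝔽ₚ-grid in standard coordinates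

    data Centre : Set where
      p₁ p₂ p₃ : Centre

    centre : Centre → V
    centre p₁ = e₁
    centre p₂ = e₂
    centre p₃ = e₁₂

    data GridPoint : Set (c ⊔ ℓ) where
      ideal  : Centre → GridPoint
      affine : (m n : Carrier) → 𝔽ₚ m → 𝔽ₚ n → GridPoint

    gridVec : GridPoint → V
    gridVec (ideal a)        = centre a
    gridVec (affine m n _ _) = m , n , 1#

    OnGrid : V → Set (c ⊔ ℓ)
    OnGrid x = Σ GridPoint λ g → x ∼ᵥ gridVec g

    -- The line joining a centre to a grid point: the line at infinity, or one of
    -- y = n z, x = m z, y - x = d z (through p₁, p₂, p₃ respectively).
    data GridLine : Set (c ⊔ ℓ) where
      line∞ : GridLine
      horizontal vertical diagonal : (n : Carrier) → 𝔽ₚ n → GridLine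

    equation : GridLine → V → Carrier
    equation line∞            (x₁ , x₂ , x₃) = x₃
    equation (horizontal n _) (x₁ , x₂ , x₃) = x₂ - n * x₃
    equation (vertical m _)   (x₁ , x₂ , x₃) = x₁ - m * x₃
    equation (diagonal d _)   (x₁ , x₂ , x₃) = (x₂ - x₁) - d * x₃

    SameGridLine : GridLine → GridLine → Set ℓ
    SameGridLine line∞            line∞             = Lift ℓ ⊤
    SameGridLine (horizontal n _) (horizontal n' _) = n ≈ n'
    SameGridLine (vertical n _)   (vertical n' _)   = n ≈ n'
    SameGridLine (diagonal n _)   (diagonal n' _)   = n ≈ n'
    SameGridLine _                _                 = Lift ℓ ⊥

    SameGridLine-equation : ∀ L L' → SameGridLine L L' → ∀ x → equation L' x ≈ 0# → equation L x ≈ 0#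
    SameGridLine-equation line∞            line∞             _    x eq = eq
    SameGridLine-equation (horizontal n _) (horizontal n' _) n≈n' x eq = trans (+-congˡ (-‿cong (*-congʳ n≈n'))) eq
    SameGridLine-equation (vertical n _)   (vertical n' _)   n≈n' x eq = trans (+-congˡ (-‿cong (*-congʳ n≈n'))) eq
    SameGridLine-equation (diagonal n _)   (diagonal n' _)   n≈n' x eq = trans (+-congˡ (-‿cong (*-congʳ n≈n'))) eq

    Spans : Centre → GridPoint → GridLine → Set (c ⊔ ℓ)
    Spans a g L = Σ Carrier λ k → k ≉ 0# × (∀ x → det (centre a) (gridVec g) x ≈ k * equation L x)

    join : ∀ a g → ¬ (gridVec g ∼ᵥ centre a) → Σ GridLine (Spans a g)
    join p₁ (ideal p₁) g≁a = ⊥-elim (g≁a ∼ᵥ-refl)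
    join p₂ (ideal p₂) g≁a = ⊥-elim (g≁a ∼ᵥ-refl)
    join p₃ (ideal p₃) g≁a = ⊥-elim (g≁a ∼ᵥ-refl)
    join p₁ (ideal p₂) _ = line∞ , 1# , 1≉0 , λ { (x₁ , x₂ , x₃) →
      solve 3 (λ x₁ x₂ x₃ → detₚ (1ₚ , 0ₚ , 0ₚ) (0ₚ , 1ₚ , 0ₚ) (x₁ , x₂ , x₃) := 1ₚ :* x₃) refl x₁ x₂ x₃ }
    join p₁ (ideal p₃) _ = line∞ , 1# , 1≉0 , λ { (x₁ , x₂ , x₃) →
      solve 3 (λ x₁ x₂ x₃ → detₚ (1ₚ , 0ₚ , 0ₚ) (1ₚ , 1ₚ , 0ₚ) (x₁ , x₂ , x₃) := 1ₚ :* x₃) refl x₁ x₂ x₃ }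
    join p₂ (ideal p₁) _ = line∞ , - 1# , -‿≉0 1≉0 , λ { (x₁ , x₂ , x₃) →
      solve 3 (λ x₁ x₂ x₃ → detₚ (0ₚ , 1ₚ , 0ₚ) (1ₚ , 0ₚ , 0ₚ) (x₁ , x₂ , x₃) := :- 1ₚ :* x₃) refl x₁ x₂ x₃ }
    join p₂ (ideal p₃) _ = line∞ , - 1# , -‿≉0 1≉0 , λ { (x₁ , x₂ , x₃) →
      solve 3 (λ x₁ x₂ x₃ → detₚ (0ₚ , 1ₚ , 0ₚ) (1ₚ , 1ₚ , 0ₚ) (x₁ , x₂ , x₃) := :- 1ₚ :* x₃) refl x₁ x₂ x₃ }
    join p₃ (ideal p₁) _ = line∞ , - 1# , -‿≉0 1≉0 , λ { (x₁ , x₂ , x₃) →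
      solve 3 (λ x₁ x₂ x₃ → detₚ (1ₚ , 1ₚ , 0ₚ) (1ₚ , 0ₚ , 0ₚ) (x₁ , x₂ , x₃) := :- 1ₚ :* x₃) refl x₁ x₂ x₃ }
    join p₃ (ideal p₂) _ = line∞ , 1# , 1≉0 , λ { (x₁ , x₂ , x₃) →
      solve 3 (λ x₁ x₂ x₃ → detₚ (1ₚ , 1ₚ , 0ₚ) (0ₚ , 1ₚ , 0ₚ) (x₁ , x₂ , x₃) := 1ₚ :* x₃) refl x₁ x₂ x₃ }
    join p₁ (affine m n m∈𝔽ₚ n∈𝔽ₚ) _ = horizontal n n∈𝔽ₚ , - 1# , -‿≉0 1≉0 , λ { (x₁ , x₂ , x₃) →
      solve 5 (λ m n x₁ x₂ x₃ → detₚ (1ₚ , 0ₚ , 0ₚ) (m , n , 1ₚ) (x₁ , x₂ , x₃) := :- 1ₚ :* (x₂ :- n :* x₃))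
        refl m n x₁ x₂ x₃ }
    join p₂ (affine m n m∈𝔽ₚ n∈𝔽ₚ) _ = vertical m m∈𝔽ₚ , 1# , 1≉0 , λ { (x₁ , x₂ , x₃) →
      solve 5 (λ m n x₁ x₂ x₃ → detₚ (0ₚ , 1ₚ , 0ₚ) (m , n , 1ₚ) (x₁ , x₂ , x₃) := 1ₚ :* (x₁ :- m :* x₃))
        refl m n x₁ x₂ x₃ }
    join p₃ (affine m n m∈𝔽ₚ n∈𝔽ₚ) _ = diagonal (n - m) (𝔽ₚ-sub n∈𝔽ₚ m∈𝔽ₚ) , - 1# , -‿≉0 1≉0 , λ { (x₁ , x₂ , x₃) →
      solve 5 (λ m n x₁ x₂ x₃ → detₚ (1ₚ , 1ₚ , 0ₚ) (m , n , 1ₚ) (x₁ , x₂ , x₃)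
                                := :- 1ₚ :* ((x₂ :- x₁) :- (n :- m) :* x₃))
        refl m n x₁ x₂ x₃ }

    ideal-on-grid : ∀ a {x} k → x ≈₃ (k ·₃ centre a) → ¬ (x ≈₃ 0₃) → OnGrid x
    ideal-on-grid a k x≈k·a x≉0 = ideal a , k , k≉0 , x≈k·a
      where
      k≉0 : k ≉ 0#
      k≉0 k≈0 = x≉0 (≈₃-trans x≈k·a (≈₃-trans (·₃-cong k≈0 ≈₃-refl) (·₃-zero _)))

    affine-on-grid : ∀ {x₁ x₂ x₃ m n} → 𝔽ₚ m → 𝔽ₚ n → x₁ ≈ m * x₃ → x₂ ≈ n * x₃ →
                     ¬ ((x₁ , x₂ , x₃) ≈₃ 0₃) → OnGrid (x₁ , x₂ , x₃)
    affine-on-grid {x₁} {x₂} {x₃} {m} {n} m∈𝔽ₚ n∈𝔽ₚ x₁≈mx₃ x₂≈nx₃ x≉0 =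
      affine m n m∈𝔽ₚ n∈𝔽ₚ , x₃ , x₃≉0 ,
        trans x₁≈mx₃ (*-comm m x₃) , trans x₂≈nx₃ (*-comm n x₃) , sym (*-identityʳ x₃)
      where
      x₃≉0 : x₃ ≉ 0#
      x₃≉0 x₃≈0 = x≉0 (trans x₁≈mx₃ (y≈0⇒x*y≈0 x₃≈0) , trans x₂≈nx₃ (y≈0⇒x*y≈0 x₃≈0) , x₃≈0)

    meet-line∞ : ∀ L x → ¬ SameGridLine line∞ L → ¬ (x ≈₃ 0₃) →
                 equation line∞ x ≈ 0# → equation L x ≈ 0# → OnGrid x
    meet-line∞ line∞ x L≠line∞ _ _ _ = ⊥-elim (L≠line∞ (lift tt))
    meet-line∞ (horizontal n _) (x₁ , x₂ , x₃) _ x≉0 x₃≈0 eq = ideal-on-grid p₁ x₁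
      (sym (*-identityʳ x₁) , x≈0⇒x≈y*0 x₁ (trans (x-y≈0⇒x≈y eq) (y≈0⇒x*y≈0 x₃≈0)) , x≈0⇒x≈y*0 x₁ x₃≈0) x≉0
    meet-line∞ (vertical m _) (x₁ , x₂ , x₃) _ x≉0 x₃≈0 eq = ideal-on-grid p₂ x₂
      (x≈0⇒x≈y*0 x₂ (trans (x-y≈0⇒x≈y eq) (y≈0⇒x*y≈0 x₃≈0)) , sym (*-identityʳ x₂) , x≈0⇒x≈y*0 x₂ x₃≈0) x≉0
    meet-line∞ (diagonal d _) (x₁ , x₂ , x₃) _ x≉0 x₃≈0 eq = ideal-on-grid p₃ x₁
      (sym (*-identityʳ x₁) , trans x₂≈x₁ (sym (*-identityʳ x₁)) , x≈0⇒x≈y*0 x₁ x₃≈0) x≉0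
      where
      x₂≈x₁ : x₂ ≈ x₁
      x₂≈x₁ = x-y≈0⇒x≈y (trans (x-y≈0⇒x≈y eq) (y≈0⇒x*y≈0 x₃≈0))

    distinct-multiples⇒≈0 : ∀ {x z n n'} → n ≉ n' → x ≈ n * z → x ≈ n' * z → z ≈ 0#
    distinct-multiples⇒≈0 {x} {z} {n} {n'} n≉n' x≈nz x≈n'z =
      x*y≈0⇒y≈0 (λ n-n'≈0 → n≉n' (x-y≈0⇒x≈y n-n'≈0))
        (trans ([y-z]x≈yx-zx z n n') (x≈y⇒x∙y⁻¹≈ε (trans (sym x≈nz) x≈n'z)))

    horizontal∩diagonal : ∀ {x₁ x₂ x₃ n d} → x₂ ≈ n * x₃ → x₂ - x₁ ≈ d * x₃ → x₁ ≈ (n - d) * x₃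
    horizontal∩diagonal {x₁} {x₂} {x₃} {n} {d} x₂≈nx₃ x₂-x₁≈dx₃ = begin
      x₁                 ≈⟨ x≈y-[y-x] x₁ x₂ ⟩
      x₂ - (x₂ - x₁)     ≈⟨ +-cong x₂≈nx₃ (-‿cong x₂-x₁≈dx₃) ⟩
      n * x₃ - d * x₃    ≈⟨ [y-z]x≈yx-zx x₃ n d ⟨
      (n - d) * x₃       ∎
      where
      x≈y-[y-x] : ∀ x y → x ≈ y - (y - x)
      x≈y-[y-x] = solve 2 (λ x y → x := y :- (y :- x)) refl

    vertical∩diagonal : ∀ {x₁ x₂ x₃ m d} → x₁ ≈ m * x₃ → x₂ - x₁ ≈ d * x₃ → x₂ ≈ (m + d) * x₃
    vertical∩diagonal {x₁} {x₂} {x₃} {m} {d} x₁≈mx₃ x₂-x₁≈dx₃ = begin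
      x₂                 ≈⟨ y≈x+[y-x] x₁ x₂ ⟩
      x₁ + (x₂ - x₁)     ≈⟨ +-cong x₁≈mx₃ x₂-x₁≈dx₃ ⟩
      m * x₃ + d * x₃    ≈⟨ distribʳ x₃ m d ⟨
      (m + d) * x₃       ∎
      where
      y≈x+[y-x] : ∀ x y → y ≈ x + (y - x)
      y≈x+[y-x] = solve 2 (λ x y → y := x :+ (y :- x)) refl

    meet-on-grid : ∀ L L' x → ¬ SameGridLine L L' → ¬ (x ≈₃ 0₃) →
                   equation L x ≈ 0# → equation L' x ≈ 0# → OnGrid x
    meet-on-grid line∞ L' x L≠L' x≉0 eq eq' = meet-line∞ L' x L≠L' x≉0 eq eq'
    meet-on-grid L@(horizontal _ _) line∞ x _ x≉0 eq eq' = meet-line∞ L x (λ { (lift ()) }) x≉0 eq' eq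
    meet-on-grid L@(vertical _ _)   line∞ x _ x≉0 eq eq' = meet-line∞ L x (λ { (lift ()) }) x≉0 eq' eq
    meet-on-grid L@(diagonal _ _)   line∞ x _ x≉0 eq eq' = meet-line∞ L x (λ { (lift ()) }) x≉0 eq' eq
    meet-on-grid L@(horizontal _ _) (horizontal _ _) x n≉n' x≉0 eq eq' =
      meet-line∞ L x (λ { (lift ()) }) x≉0 (distinct-multiples⇒≈0 n≉n' (x-y≈0⇒x≈y eq) (x-y≈0⇒x≈y eq')) eq
    meet-on-grid L@(vertical _ _)   (vertical _ _)   x m≉m' x≉0 eq eq' =
      meet-line∞ L x (λ { (lift ()) }) x≉0 (distinct-multiples⇒≈0 m≉m' (x-y≈0⇒x≈y eq) (x-y≈0⇒x≈y eq')) eq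
    meet-on-grid L@(diagonal _ _)   (diagonal _ _)   x d≉d' x≉0 eq eq' =
      meet-line∞ L x (λ { (lift ()) }) x≉0 (distinct-multiples⇒≈0 d≉d' (x-y≈0⇒x≈y eq) (x-y≈0⇒x≈y eq')) eq
    meet-on-grid (horizontal n n∈𝔽ₚ) (vertical m m∈𝔽ₚ) x _ x≉0 eq eq' =
      affine-on-grid m∈𝔽ₚ n∈𝔽ₚ (x-y≈0⇒x≈y eq') (x-y≈0⇒x≈y eq) x≉0
    meet-on-grid (vertical m m∈𝔽ₚ) (horizontal n n∈𝔽ₚ) x _ x≉0 eq eq' =
      affine-on-grid m∈𝔽ₚ n∈𝔽ₚ (x-y≈0⇒x≈y eq) (x-y≈0⇒x≈y eq') x≉0
    meet-on-grid (horizontal n n∈𝔽ₚ) (diagonal d d∈𝔽ₚ) x _ x≉0 eq eq' =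
      affine-on-grid (𝔽ₚ-sub n∈𝔽ₚ d∈𝔽ₚ) n∈𝔽ₚ
        (horizontal∩diagonal (x-y≈0⇒x≈y eq) (x-y≈0⇒x≈y eq')) (x-y≈0⇒x≈y eq) x≉0
    meet-on-grid (diagonal d d∈𝔽ₚ) (horizontal n n∈𝔽ₚ) x _ x≉0 eq eq' =
      affine-on-grid (𝔽ₚ-sub n∈𝔽ₚ d∈𝔽ₚ) n∈𝔽ₚ
        (horizontal∩diagonal (x-y≈0⇒x≈y eq') (x-y≈0⇒x≈y eq)) (x-y≈0⇒x≈y eq') x≉0
    meet-on-grid (vertical m m∈𝔽ₚ) (diagonal d d∈𝔽ₚ) x _ x≉0 eq eq' =
      affine-on-grid m∈𝔽ₚ (𝔽ₚ-+ m∈𝔽ₚ d∈𝔽ₚ)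
        (x-y≈0⇒x≈y eq) (vertical∩diagonal (x-y≈0⇒x≈y eq) (x-y≈0⇒x≈y eq')) x≉0
    meet-on-grid (diagonal d d∈𝔽ₚ) (vertical m m∈𝔽ₚ) x _ x≉0 eq eq' =
      affine-on-grid m∈𝔽ₚ (𝔽ₚ-+ m∈𝔽ₚ d∈𝔽ₚ)
        (x-y≈0⇒x≈y eq') (vertical∩diagonal (x-y≈0⇒x≈y eq') (x-y≈0⇒x≈y eq)) x≉0

    join-meet-on-grid : ∀ a g a' g' → ¬ (gridVec g ∼ᵥ centre a) → ¬ (gridVec g' ∼ᵥ centre a') →
      ¬ (det (centre a) (gridVec g) (centre a') ≈ 0# × det (centre a) (gridVec g) (gridVec g') ≈ 0#) →
      ∀ x → ¬ (x ≈₃ 0₃) → det (centre a) (gridVec g) x ≈ 0# → det (centre a') (gridVec g') x ≈ 0# → OnGrid x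
    join-meet-on-grid a g a' g' g≁a g'≁a' distinct x x≉0 on on'
      with join a g g≁a | join a' g' g'≁a'
    ... | L , k , k≉0 , det≈kL | L' , k' , k'≉0 , det≈k'L' =
      meet-on-grid L L' x L≠L' x≉0 (on-L x on) (on-L' x on')
      where
      on-L : ∀ y → det (centre a) (gridVec g) y ≈ 0# → equation L y ≈ 0#
      on-L y on = x*y≈0⇒y≈0 k≉0 (trans (sym (det≈kL y)) on)
      on-L' : ∀ y → det (centre a') (gridVec g') y ≈ 0# → equation L' y ≈ 0#
      on-L' y on' = x*y≈0⇒y≈0 k'≉0 (trans (sym (det≈k'L' y)) on')
      L'⊆L : SameGridLine L L' → ∀ y → det (centre a') (gridVec g') y ≈ 0# → det (centre a) (gridVec g) y ≈ 0#
      L'⊆L same y on' = trans (det≈kL y) (y≈0⇒x*y≈0 (SameGridLine-equation L L' same y (on-L' y on')))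
      L≠L' : ¬ SameGridLine L L'
      L≠L' same = distinct ( L'⊆L same (centre a') (det-repeat₁₃ (centre a') (gridVec g'))
                           , L'⊆L same (gridVec g') (det-repeat₂₃ (centre a') (gridVec g')))

    centre-on-line∞ : ∀ a → equation line∞ (centre a) ≈ 0#
    centre-on-line∞ p₁ = refl
    centre-on-line∞ p₂ = refl
    centre-on-line∞ p₃ = refl

    affine≁centre : ∀ {x y} a → ¬ ((x , y , 1#) ∼ᵥ centre a)
    affine≁centre {x} {y} a (k , _ , _ , _ , 1≈k*z) = 1≉0 (trans 1≈k*z (y≈0⇒x*y≈0 (centre-on-line∞ a)))

    module StandardFrame (M : M3) (P₁ P₂ Q₁ Q₂ P₃ : Point) (detM≉0 : detM M ≉ 0#)
        (P₁∼e₁ : apply M (vec P₁) ∼ᵥ e₁) (P₂∼e₂ : apply M (vec P₂) ∼ᵥ e₂)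
        (Q₁∼e₃ : apply M (vec Q₁) ∼ᵥ e₃) (Q₂∼e₁₂₃ : apply M (vec Q₂) ∼ᵥ e₁₂₃)
        (P₁P₂P₃ : Collinear P₁ P₂ P₃) (Q₁Q₂P₃ : Collinear Q₁ Q₂ P₃) where
      open Collineation M detM≉0

      Cen : Point → Set (c ⊔ ℓ)
      Cen = In3 P₁ P₂ P₃

      Cl : Point → Set (c ⊔ ℓ)
      Cl = Closure (In5 P₁ P₂ P₃ Q₁ Q₂) Cen

      P₁↦e₁ : P₁ ↦ e₁
      P₁↦e₁ = mk↦ P₁∼e₁

      P₂↦e₂ : P₂ ↦ e₂
      P₂↦e₂ = mk↦ P₂∼e₂

      Q₁↦e₃ : Q₁ ↦ e₃
      Q₁↦e₃ = mk↦ Q₁∼e₃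

      Q₂↦e₁₂₃ : Q₂ ↦ e₁₂₃
      Q₂↦e₁₂₃ = mk↦ Q₂∼e₁₂₃

      P₃↦e₁₂ : P₃ ↦ e₁₂
      P₃↦e₁₂ = mk↦ (u₁ , u₁≉0 , sym (*-identityʳ u₁) , trans u₂≈u₁ (sym (*-identityʳ u₁)) , x≈0⇒x≈y*0 u₁ u₃≈0)
        where
        u₁ u₂ u₃ : Carrier
        u₁ = proj₁ (apply M (vec P₃))
        u₂ = proj₁ (proj₂ (apply M (vec P₃)))
        u₃ = proj₂ (proj₂ (apply M (vec P₃)))
        u₃≈0 : u₃ ≈ 0#
        u₃≈0 = trans (sym (det-e₁e₂ u₁ u₂ u₃)) (↦-collinear P₁↦e₁ P₂↦e₂ (↦-self P₃) P₁P₂P₃)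
        u₂≈u₁ : u₂ ≈ u₁
        u₂≈u₁ = x-y≈0⇒x≈y (trans (sym (det-e₃e₁₂₃ u₁ u₂ u₃)) (↦-collinear Q₁↦e₃ Q₂↦e₁₂₃ (↦-self P₃) Q₁Q₂P₃))
        u₁≉0 : u₁ ≉ 0#
        u₁≉0 u₁≈0 = apply-≉0₃ (proj₂ P₃) (u₁≈0 , trans u₂≈u₁ u₁≈0 , u₃≈0)

      centrePoint : Centre → Point
      centrePoint p₁ = P₁
      centrePoint p₂ = P₂
      centrePoint p₃ = P₃

      centrePoint-Cen : ∀ a → Cen (centrePoint a)
      centrePoint-Cen p₁ = inj₁ ∼ᵥ-refl
      centrePoint-Cen p₂ = inj₂ (inj₁ ∼ᵥ-refl)
      centrePoint-Cen p₃ = inj₂ (inj₂ ∼ᵥ-refl)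

      centrePoint↦ : ∀ a → centrePoint a ↦ centre a
      centrePoint↦ p₁ = P₁↦e₁
      centrePoint↦ p₂ = P₂↦e₂
      centrePoint↦ p₃ = P₃↦e₁₂

      Cen↦centre : ∀ {A} → Cen A → Σ Centre λ a → A ↦ centre a
      Cen↦centre (inj₁ A∼P₁)        = p₁ , ↦-resp-∼ A∼P₁ P₁↦e₁
      Cen↦centre (inj₂ (inj₁ A∼P₂)) = p₂ , ↦-resp-∼ A∼P₂ P₂↦e₂
      Cen↦centre (inj₂ (inj₂ A∼P₃)) = p₃ , ↦-resp-∼ A∼P₃ P₃↦e₁₂

      closure↦grid : ∀ {X} → Cl X → Σ GridPoint λ g → X ↦ gridVec g
      closure↦grid (base (inj₁ X∼P₁))                         = ideal p₁ , ↦-resp-∼ X∼P₁ P₁↦e₁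
      closure↦grid (base (inj₂ (inj₁ X∼P₂)))                  = ideal p₂ , ↦-resp-∼ X∼P₂ P₂↦e₂
      closure↦grid (base (inj₂ (inj₂ (inj₁ X∼P₃))))           = ideal p₃ , ↦-resp-∼ X∼P₃ P₃↦e₁₂
      closure↦grid (base (inj₂ (inj₂ (inj₂ (inj₁ X∼Q₁)))))    =
        affine 0# 0# 𝔽ₚ-0# 𝔽ₚ-0# , ↦-resp-∼ X∼Q₁ Q₁↦e₃
      closure↦grid (base (inj₂ (inj₂ (inj₂ (inj₂ X∼Q₂)))))    =
        affine 1# 1# 𝔽ₚ-1# 𝔽ₚ-1# , ↦-resp-∼ X∼Q₂ Q₂↦e₁₂₃
      closure↦grid {X} (meet {A = A} {Q} {A'} {Q'} A∈Cen Q∈Cl Q≁A A'∈Cen Q'∈Cl Q'≁A' distinct AQX A'Q'X)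
        with Cen↦centre {A} A∈Cen | closure↦grid Q∈Cl | Cen↦centre {A'} A'∈Cen | closure↦grid Q'∈Cl
      ... | a , A↦ | g , Q↦ | a' , A'↦ | g' , Q'↦ = proj₁ X-on-grid , mk↦ (proj₂ X-on-grid)
        where
        X-on-grid : OnGrid (apply M (vec X))
        X-on-grid = join-meet-on-grid a g a' g'
          (λ g∼a → Q≁A (↦-∼⁻¹ Q↦ A↦ g∼a)) (λ g'∼a' → Q'≁A' (↦-∼⁻¹ Q'↦ A'↦ g'∼a'))
          (λ { (AQA' , AQQ') → distinct (↦-collinear⁻¹ A↦ Q↦ A'↦ AQA' , ↦-collinear⁻¹ A↦ Q↦ Q'↦ AQQ') })
          (apply M (vec X)) (apply-≉0₃ (proj₂ X))
          (↦-collinear A↦ Q↦ (↦-self X) AQX) (↦-collinear A'↦ Q'↦ (↦-self X) A'Q'X)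

      closure⇒subplane : ∀ {X} → Cl X → ¬ Collinear P₁ P₂ X → InSubplane P₁ P₂ Q₁ Q₂ X
      closure⇒subplane X∈Cl ¬P₁P₂X with closure↦grid X∈Cl
      ... | ideal a , X↦a =
        ⊥-elim (¬P₁P₂X (↦-collinear⁻¹ P₁↦e₁ P₂↦e₂ X↦a (trans (det-e₁e₂ _ _ _) (centre-on-line∞ a))))
      ... | affine m n m∈𝔽ₚ n∈𝔽ₚ , mk↦ X∼mn1 = M , detM≉0 , P₁∼e₁ , P₂∼e₂ , Q₁∼e₃ , Q₂∼e₁₂₃ ,
        (m , n , 1#) , X∼mn1 , m∈𝔽ₚ , n∈𝔽ₚ , 𝔽ₚ-1#

      affineVec : ℕ → ℕ → V
      affineVec m n = fromℕ m , fromℕ n , 1#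

      affineVec≉0₃ : ∀ m n → ¬ (affineVec m n ≈₃ 0₃)
      affineVec≉0₃ m n (_ , _ , 1≈0) = 1≉0 1≈0

      gridPoint : ℕ → ℕ → Point
      gridPoint m n = proj₁ (preimage (affineVec m n) (affineVec≉0₃ m n))

      gridPoint↦ : ∀ m n → gridPoint m n ↦ affineVec m n
      gridPoint↦ m n = mk↦ (proj₂ (preimage (affineVec m n) (affineVec≉0₃ m n)))

      meet-of-joins : ∀ a m n a' m' n' {X u} → Cl (gridPoint m n) → Cl (gridPoint m' n') → X ↦ u →
        det (centre a) (affineVec m n) (centre a') ≉ 0# →
        det (centre a) (affineVec m n) u ≈ 0# → det (centre a') (affineVec m' n') u ≈ 0# → Cl X
      meet-of-joins a m n a' m' n' {X} Q∈Cl Q'∈Cl X↦u nondegenerate on on' =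
        meet {X = X} {A = centrePoint a} {Q = gridPoint m n} {A' = centrePoint a'} {Q' = gridPoint m' n'}
          (centrePoint-Cen a) Q∈Cl (λ Q∼A → affine≁centre a (↦-∼ (gridPoint↦ m n) (centrePoint↦ a) Q∼A))
          (centrePoint-Cen a') Q'∈Cl (λ Q'∼A' → affine≁centre a' (↦-∼ (gridPoint↦ m' n') (centrePoint↦ a') Q'∼A'))
          (λ { (AQA' , _) → nondegenerate (↦-collinear (centrePoint↦ a) (gridPoint↦ m n) (centrePoint↦ a') AQA') })
          (↦-collinear⁻¹ (centrePoint↦ a) (gridPoint↦ m n) X↦u on)
          (↦-collinear⁻¹ (centrePoint↦ a') (gridPoint↦ m' n') X↦u on')

      origin∈Cl : ∀ {X} → X ↦ affineVec 0 0 → Cl X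
      origin∈Cl X↦ = base (inj₂ (inj₂ (inj₂ (inj₁ (↦-∼⁻¹ X↦ Q₁↦e₃ ∼ᵥ-refl)))))

      unit∈Cl : ∀ {X} → X ↦ affineVec 1 1 → Cl X
      unit∈Cl X↦ = base (inj₂ (inj₂ (inj₂ (inj₂
        (↦-∼⁻¹ X↦ Q₂↦e₁₂₃ (≈₃⇒∼ᵥ (+-identityʳ 1# , +-identityʳ 1# , refl)))))))

      -- (a+1, 1) is on the diagonal through (a, 0) and the horizontal through (1, 1);
      -- (a+1, 0) is on the vertical through (a+1, 1) and the horizontal through (0, 0).
      row∈Cl : ∀ a {X} → X ↦ affineVec a 0 → Cl X
      row∈Cl zero    X↦ = origin∈Cl X↦
      row∈Cl (suc a) X↦ = meet-of-joins p₂ (suc a) 1 p₁ 0 0 step (origin∈Cl (gridPoint↦ 0 0)) X↦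
        (x≈1⇒x≉0 (solve 1 (λ A → detₚ (0ₚ , 1ₚ , 0ₚ) (1ₚ :+ A , 1ₚ :+ 0ₚ , 1ₚ) (1ₚ , 0ₚ , 0ₚ) := 1ₚ) refl (fromℕ a)))
        (solve 1 (λ A → detₚ (0ₚ , 1ₚ , 0ₚ) (1ₚ :+ A , 1ₚ :+ 0ₚ , 1ₚ) (1ₚ :+ A , 0ₚ , 1ₚ) := 0ₚ) refl (fromℕ a))
        (solve 1 (λ A → detₚ (1ₚ , 0ₚ , 0ₚ) (0ₚ , 0ₚ , 1ₚ) (1ₚ :+ A , 0ₚ , 1ₚ) := 0ₚ) refl (fromℕ a))
        where
        step : Cl (gridPoint (suc a) 1)
        step = meet-of-joins p₃ a 0 p₁ 1 1 (row∈Cl a (gridPoint↦ a 0)) (unit∈Cl (gridPoint↦ 1 1)) (gridPoint↦ (suc a) 1)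
          (x≈1⇒x≉0 (solve 1 (λ A → detₚ (1ₚ , 1ₚ , 0ₚ) (A , 0ₚ , 1ₚ) (1ₚ , 0ₚ , 0ₚ) := 1ₚ) refl (fromℕ a)))
          (solve 1 (λ A → detₚ (1ₚ , 1ₚ , 0ₚ) (A , 0ₚ , 1ₚ) (1ₚ :+ A , 1ₚ :+ 0ₚ , 1ₚ) := 0ₚ) refl (fromℕ a))
          (solve 1 (λ A → detₚ (1ₚ , 0ₚ , 0ₚ) (1ₚ :+ 0ₚ , 1ₚ :+ 0ₚ , 1ₚ) (1ₚ :+ A , 1ₚ :+ 0ₚ , 1ₚ) := 0ₚ) refl (fromℕ a))

      -- (1, b+1) is on the diagonal through (0, b) and the vertical through (1, 1);
      -- (0, b+1) is on the horizontal through (1, b+1) and the vertical through (0, 0).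
      column∈Cl : ∀ b {X} → X ↦ affineVec 0 b → Cl X
      column∈Cl zero    X↦ = origin∈Cl X↦
      column∈Cl (suc b) X↦ = meet-of-joins p₁ 1 (suc b) p₂ 0 0 step (origin∈Cl (gridPoint↦ 0 0)) X↦
        (x≈-1⇒x≉0 (solve 1 (λ B → detₚ (1ₚ , 0ₚ , 0ₚ) (1ₚ :+ 0ₚ , 1ₚ :+ B , 1ₚ) (0ₚ , 1ₚ , 0ₚ) := :- 1ₚ) refl (fromℕ b)))
        (solve 1 (λ B → detₚ (1ₚ , 0ₚ , 0ₚ) (1ₚ :+ 0ₚ , 1ₚ :+ B , 1ₚ) (0ₚ , 1ₚ :+ B , 1ₚ) := 0ₚ) refl (fromℕ b))
        (solve 1 (λ B → detₚ (0ₚ , 1ₚ , 0ₚ) (0ₚ , 0ₚ , 1ₚ) (0ₚ , 1ₚ :+ B , 1ₚ) := 0ₚ) refl (fromℕ b))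
        where
        step : Cl (gridPoint 1 (suc b))
        step = meet-of-joins p₃ 0 b p₂ 1 1 (column∈Cl b (gridPoint↦ 0 b)) (unit∈Cl (gridPoint↦ 1 1)) (gridPoint↦ 1 (suc b))
          (x≈-1⇒x≉0 (solve 1 (λ B → detₚ (1ₚ , 1ₚ , 0ₚ) (0ₚ , B , 1ₚ) (0ₚ , 1ₚ , 0ₚ) := :- 1ₚ) refl (fromℕ b)))
          (solve 1 (λ B → detₚ (1ₚ , 1ₚ , 0ₚ) (0ₚ , B , 1ₚ) (1ₚ :+ 0ₚ , 1ₚ :+ B , 1ₚ) := 0ₚ) refl (fromℕ b))
          (solve 1 (λ B → detₚ (0ₚ , 1ₚ , 0ₚ) (1ₚ :+ 0ₚ , 1ₚ :+ 0ₚ , 1ₚ) (1ₚ :+ 0ₚ , 1ₚ :+ B , 1ₚ) := 0ₚ) refl (fromℕ b))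

      -- (a, b) is on the vertical through (a, 0) and the horizontal through (0, b).
      grid∈Cl : ∀ a b {X} → X ↦ affineVec a b → Cl X
      grid∈Cl a b X↦ = meet-of-joins p₂ a 0 p₁ 0 b (row∈Cl a (gridPoint↦ a 0)) (column∈Cl b (gridPoint↦ 0 b)) X↦
        (x≈1⇒x≉0 (solve 1 (λ A → detₚ (0ₚ , 1ₚ , 0ₚ) (A , 0ₚ , 1ₚ) (1ₚ , 0ₚ , 0ₚ) := 1ₚ) refl (fromℕ a)))
        (solve 2 (λ A B → detₚ (0ₚ , 1ₚ , 0ₚ) (A , 0ₚ , 1ₚ) (A , B , 1ₚ) := 0ₚ) refl (fromℕ a) (fromℕ b))
        (solve 2 (λ A B → detₚ (1ₚ , 0ₚ , 0ₚ) (0ₚ , B , 1ₚ) (A , B , 1ₚ) := 0ₚ) refl (fromℕ a) (fromℕ b))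

      subplane⇒closure : ∀ {X} → ¬ Collinear P₁ P₂ X → InPrimeSubplane (apply M (vec X)) → Cl X
      subplane⇒closure {X} ¬P₁P₂X ((w₁ , w₂ , w₃) , X∼w , w₁∈𝔽ₚ , w₂∈𝔽ₚ , w₃∈𝔽ₚ) =
        grid∈Cl m n (mk↦ (∼ᵥ-trans X∼w (w₃ , w₃≉0 , rescale w₁y≈m , rescale w₂y≈n , sym (*-identityʳ w₃))))
        where
        open import Algebra.Properties.CommutativeSemigroup *-commutativeSemigroup using (x∙yz≈y∙xz)
        w₃≉0 : w₃ ≉ 0#
        w₃≉0 w₃≈0 = ¬P₁P₂X (↦-collinear⁻¹ P₁↦e₁ P₂↦e₂ (mk↦ {X} X∼w) (trans (det-e₁e₂ w₁ w₂ w₃) w₃≈0))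
        w₃⁻¹ : ∃ λ y → 𝔽ₚ y × w₃ * y ≈ 1#
        w₃⁻¹ = 𝔽ₚ-inverse w₃∈𝔽ₚ w₃≉0
        y : Carrier
        y = proj₁ w₃⁻¹
        rescale : ∀ {x k} → x * y ≈ k → x ≈ w₃ * k
        rescale {x} {k} xy≈k = begin
          x              ≈⟨ *-identityʳ x ⟨
          x * 1#         ≈⟨ *-congˡ (proj₂ (proj₂ w₃⁻¹)) ⟨
          x * (w₃ * y)   ≈⟨ x∙yz≈y∙xz x w₃ y ⟩
          w₃ * (x * y)   ≈⟨ *-congˡ xy≈k ⟩
          w₃ * k         ∎
        m n : ℕ
        m = proj₁ (𝔽ₚ-* w₁∈𝔽ₚ (proj₁ (proj₂ w₃⁻¹)))
        n = proj₁ (𝔽ₚ-* w₂∈𝔽ₚ (proj₁ (proj₂ w₃⁻¹)))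
        w₁y≈m : w₁ * y ≈ fromℕ m
        w₁y≈m = proj₂ (𝔽ₚ-* w₁∈𝔽ₚ (proj₁ (proj₂ w₃⁻¹)))
        w₂y≈n : w₂ * y ≈ fromℕ n
        w₂y≈n = proj₂ (𝔽ₚ-* w₂∈𝔽ₚ (proj₁ (proj₂ w₃⁻¹)))

lemma5p4 : ∀ {c ℓ} (F : Field c ℓ) (p h : ℕ) → Prime p → HasOrder F (p ^ h) →
    let open PG F in
    (P₁ P₂ Q₁ Q₂ P₃ : Point) →
    Frame P₁ P₂ Q₁ Q₂ →
    Collinear P₁ P₂ P₃ → Collinear Q₁ Q₂ P₃ →
    (X : Point) → ¬ Collinear P₁ P₂ X →
    (Closure (In5 P₁ P₂ P₃ Q₁ Q₂) (In3 P₁ P₂ P₃) X ⇔ InSubplane P₁ P₂ Q₁ Q₂ X)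
lemma5p4 F p h _ order P₁ P₂ Q₁ Q₂ P₃ frame P₁P₂P₃ Q₁Q₂P₃ X ¬P₁P₂X = mk⇔ to from
  where
  open PG F
  open Plane F
  open FiniteField (p ^ h) order

  to : Closure (In5 P₁ P₂ P₃ Q₁ Q₂) (In3 P₁ P₂ P₃) X → InSubplane P₁ P₂ Q₁ Q₂ X
  to X∈Cl =
    let M , detM≉0 , P₁∼e₁ , P₂∼e₂ , Q₁∼e₃ , Q₂∼e₁₂₃ = frame-normalisable P₁ P₂ Q₁ Q₂ frame
        open StandardFrame M P₁ P₂ Q₁ Q₂ P₃ detM≉0 P₁∼e₁ P₂∼e₂ Q₁∼e₃ Q₂∼e₁₂₃ P₁P₂P₃ Q₁Q₂P₃
    in closure⇒subplane X∈Cl ¬P₁P₂X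

  from : InSubplane P₁ P₂ Q₁ Q₂ X → Closure (In5 P₁ P₂ P₃ Q₁ Q₂) (In3 P₁ P₂ P₃) X
  from (M , detM≉0 , P₁∼e₁ , P₂∼e₂ , Q₁∼e₃ , Q₂∼e₁₂₃ , X∈subplane) = subplane⇒closure ¬P₁P₂X X∈subplane
    where
    open StandardFrame M P₁ P₂ Q₁ Q₂ P₃ detM≉0 P₁∼e₁ P₂∼e₂ Q₁∼e₃ Q₂∼e₁₂₃ P₁P₂P₃ Q₁Q₂P₃
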